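{- Let $T$ be a regular thread and $k\in\mathbb{N}$. If $[\![T]\!]^k_{\mathcal{M}}$ is total on all meadows $\mathcal{M}$, then there exists a finite thread $T'$ such that $[\![T]\!]^k_{\mathcal{M}}=[\![T']\!]^k_{\mathcal{M}}$ for all meadows $\mathcal{M}$.
   Context: A meadow is a commutative ring with unit with a total unary operation $x\mapsto x^{ -1}$ satisfying $(x^{ -1})^{ -1}=x$ and $x\cdot(x\cdot x^{ -1})=x$. Variables: input $x_0,x_1,\dots$, auxiliary $a_0,a_1,\dots$, output $y$. Actions (for auxiliary $a,a'$, input $x$): assignments $a.\mathtt{cp}(x)$ ($a:=x$), $a.\mathtt{set{:}0}$, $a.\mathtt{set{:}1}$, $a.\mathtt{set{:}ai}$ ($a:=-a$), $a.\mathtt{set{:}mi}$ ($a:=a^{ -1}$), $a.\mathtt{set{:}a}(a')$ ($a:=a+a'$), $a.\mathtt{set{:}m}(a')$ ($a:=a\cdot a'$), $y.\mathtt{cp}(a)$ ($y:=a$), which always reply $\mathtt{true}$; and the test $a.\mathtt{test{:}0}$, which changes nothing and replies $\mathtt{true}$ iff the value of $a$ is $0$. A thread is a (possibly infinite) binary tree: either $\mathsf{S}$ (termination), $\mathsf{D}$ (deadlock), or $T_1\trianglelefteq \mathtt{a}\trianglerighteq T_2$ for an action $\mathtt{a}$ and threads $T_1,T_2$ (perform $\mathtt{a}$, then continue as $T_1$ on reply $\mathtt{true}$ and as $T_2$ on reply $\mathtt{false}$); $\mathtt{a}\circ T$ abbreviates $T\trianglelefteq\mathtt{a}\trianglerighteq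 T$. A thread is finite if its tree is finite and regular if it has only finitely many distinct subthreads (equivalently, it is the behaviour of an instruction sequence in program algebra PGA). Assignments occur only as prefixes $\mathtt{a}\circ T$. For a meadow $\mathcal{M}$, a state is a map $\alpha$ from variables to $\mathcal{M}$. Running $T$ from $\alpha$: $\mathsf{S}$ terminates, $\mathsf{D}$ deadlocks, an assignment updates the state and continues, a test $a.\mathtt{test{:}0}$ continues with the left branch if $\alpha(a)=0$ and the right branch otherwise. For $m_0,\dots,m_k\in\mathcal{M}$, $[\![T]\!]^k_{\mathcal{M}}(m_0,\dots,m_k)$ is the value of $y$ when the run from the initial state ($x_i=m_i$ for $i\le k$, all other variables $0$) reaches $\mathsf{S}$ after finitely many actions, and undefined otherwise. -}

module Defs where

open import Level using (Level; _⊔_) renaming (suc to lsuc)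
open import Data.Nat using (ℕ; suc; _≟_)
open import Data.Fin using (Fin; toℕ; fromℕ<)
open import Data.Nat using (_<?_)
open import Data.Product using (Σ; _×_; _,_)
open import Relation.Nullary using (¬_; yes; no)
open import Algebra.Bundles using (CommutativeRing)
open import Relation.Binary.PropositionalEquality using (_≡_)

-- Equality is the setoid
-- equality of the underlying ring, so ⁻¹ is required to respect it.

record Meadow (c ℓ : Level) : Set (lsuc (c ⊔ ℓ)) where
  field
    commutativeRing : CommutativeRing c ℓ
  open CommutativeRing commutativeRing public
  infix 8 _⁻¹
  field
    _⁻¹          : Carrier → Carrier
    ⁻¹-cong      : ∀ {x y} → x ≈ y → x ⁻¹ ≈ y ⁻¹
    ⁻¹-involutive : ∀ x → (x ⁻¹) ⁻¹ ≈ x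
    ris          : ∀ x → x * (x * x ⁻¹) ≈ x

-- Variables: input x_i and auxiliary a_i are indexed by ℕ; y is the
-- single output variable.

Aux : Set
Aux = ℕ

Input : Set
Input = ℕ

-- Assignment actions (always reply true).
data Assign : Set where
  cp   : Aux → Input → Assign   -- a.cp(x)      a := x
  set0 : Aux → Assign           -- a.set:0      a := 0
  set1 : Aux → Assign           -- a.set:1      a := 1
  ai   : Aux → Assign           -- a.set:ai     a := -a
  mi   : Aux → Assign           -- a.set:mi     a := a⁻¹
  add  : Aux → Aux → Assign     -- a.set:a(a')  a := a + a'
  mul  : Aux → Aux → Assign     -- a.set:m(a')  a := a · a'
  out  : Aux → Assign           -- y.cp(a)      y := a

data FinThread : Set where
  S    : FinThread
  D    : FinThread
  _∘_  : Assign → FinThread → FinThread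
  test : Aux → FinThread → FinThread → FinThread    -- T₁ ⊴ a.test:0 ⊵ T₂

-- Regular threads: threads with finitely many distinct subthreads,
-- presented by their (finite) set of subthreads: each of the 'size'
-- subthreads is S, D, an assignment prefix of another subthread, or a
-- test with two subthreads as branches.  The thread is the unfolding
-- from 'start'.

data Node (n : ℕ) : Set where
  S    : Node n
  D    : Node n
  _∘_  : Assign → Fin n → Node n
  test : Aux → Fin n → Fin n → Node n

record RegThread : Set where
  field
    size  : ℕ
    node  : Fin size → Node size
    start : Fin size

module Sem {c ℓ : Level} (M : Meadow c ℓ) where
  open Meadow M

  record State : Set c where
    constructor state
    field
      inp  : Input → Carrier
      aux  : Aux → Carrier
      outv : Carrier
  open State public

  update : (Aux → Carrier) → Aux → Carrier → (Aux → Carrier)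
  update f a v b with b ≟ a
  ... | yes _ = v
  ... | no  _ = f b

  exec : Assign → State → State
  exec (cp a x)   σ = state (inp σ) (update (aux σ) a (inp σ x)) (outv σ)
  exec (set0 a)   σ = state (inp σ) (update (aux σ) a 0#) (outv σ)
  exec (set1 a)   σ = state (inp σ) (update (aux σ) a 1#) (outv σ)
  exec (ai a)     σ = state (inp σ) (update (aux σ) a (- aux σ a)) (outv σ)
  exec (mi a)     σ = state (inp σ) (update (aux σ) a (aux σ a ⁻¹)) (outv σ)
  exec (add a a') σ = state (inp σ) (update (aux σ) a (aux σ a + aux σ a')) (outv σ)
  exec (mul a a') σ = state (inp σ) (update (aux σ) a (aux σ a * aux σ a')) (outv σ)
  exec (out a)    σ = state (inp σ) (aux σ) (aux σ a)

  initial : (k : ℕ) → (Fin (suc k) → Carrier) → State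
  initial k ms = state inputs (λ _ → 0#) 0#
    where
      inputs : Input → Carrier
      inputs i with i <? suc k
      ... | yes i<k = ms (fromℕ< i<k)
      ... | no  _   = 0#

  data RunF : FinThread → State → Carrier → Set (c ⊔ ℓ) where
    stop  : ∀ {σ} → RunF S σ (outv σ)
    step  : ∀ {a T σ v} → RunF T (exec a σ) v → RunF (a ∘ T) σ v
    testT : ∀ {a T₁ T₂ σ v} → aux σ a ≈ 0# → RunF T₁ σ v → RunF (test a T₁ T₂) σ v
    testF : ∀ {a T₁ T₂ σ v} → ¬ (aux σ a ≈ 0#) → RunF T₂ σ v → RunF (test a T₁ T₂) σ v

  module _ (T : RegThread) where
    open RegThread T
    data RunR : Fin size → State → Carrier → Set (c ⊔ ℓ) where
      stop  : ∀ {i σ} → node i ≡ S → RunR i σ (outv σ)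
      step  : ∀ {i a j σ v} → node i ≡ (a ∘ j) → RunR j (exec a σ) v → RunR i σ v
      testT : ∀ {i a j l σ v} → node i ≡ test a j l → aux σ a ≈ 0# → RunR j σ v → RunR i σ v
      testF : ∀ {i a j l σ v} → node i ≡ test a j l → ¬ (aux σ a ≈ 0#) → RunR l σ v → RunR i σ v

  -- ⟦T⟧^k_M (ms) ≃ v : the partial function ⟦T⟧^k_M is defined at ms with value v.
  ⟦_⟧R^_ : RegThread → (k : ℕ) → (Fin (suc k) → Carrier) → Carrier → Set (c ⊔ ℓ)
  (⟦ T ⟧R^ k) ms v = RunR T (RegThread.start T) (initial k ms) v

  ⟦_⟧F^_ : FinThread → (k : ℕ) → (Fin (suc k) → Carrier) → Carrier → Set (c ⊔ ℓ)
  (⟦ T ⟧F^ k) ms v = RunF T (initial k ms) v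

-- Run T symbolically on meadow terms, recording at each node of the resulting tree the terms
-- that the tests on the way assumed to be zero or nonzero; a node is consistent when no
-- nonzero-assumption is provable from the zero-assumptions by the meadow axioms. A run of T in
-- any meadow follows a consistent branch, so once no consistent branch from the root reaches
-- depth N, the unfolding of T to depth N has the same runs as T in every meadow.
--
-- Totality yields such an N constructively. In the term meadow with the extra axioms t = 0
-- for every term t, each justified by a proof of Q, a run of T proves Q, refutes Q, or bounds
-- the consistent branches. For Q := "some N bounds them" only the refutation needs an
-- argument, and under it excluded middle holds: König's lemma then gives an infinite
-- consistent branch, and in the term meadow over all its zero-assumptions T has no
-- terminating run, contradicting totality.
module Submission where

open import Defs
open import Level using (Level; Lift; lift; lower; _⊔_) renaming (suc to lsuc)
open import Axiom.ExcludedMiddle using (ExcludedMiddle)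
open import Axiom.DoubleNegationElimination using (em⇒dne)
open import Data.Nat using (ℕ; zero; suc; _≟_; _≤_; _<_; _<?_; _≤′_; ≤′-reflexive; ≤′-step)
import Data.Nat as ℕ
open import Data.Nat.Properties using (m≤m+n; m≤n+m; ≤⇒≤′)
open import Data.Fin using (Fin; toℕ; fromℕ<)
open import Data.Fin.Properties using (toℕ-fromℕ<)
open import Data.Product as Product using (Σ; _×_; _,_; proj₁; proj₂)
open import Data.Sum using (_⊎_; inj₁; inj₂; map₂)
open import Data.Empty using (⊥; ⊥-elim)
open import Data.List using (List; []; _∷_)
open import Data.List.Relation.Unary.Any as Any using (Any; here; there)
open import Data.List.Relation.Unary.All using (All; []; _∷_)
open import Data.List.Relation.Unary.All.Properties using (All¬⇒¬Any)
open import Data.List.Membership.Propositional using (_∈_; find; lose)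
open import Data.List.Relation.Binary.Subset.Propositional using (_⊆_)
open import Function using (_∘′_; id)
open import Relation.Nullary using (¬_; yes; no)
open import Relation.Binary.PropositionalEquality using (_≡_; refl; sym; subst; cong; cong₂)

infixl 6 _+ᵗ_
infixl 7 _*ᵗ_
infix  8 -ᵗ_ _⁻¹ᵗ

data Term : Set where
  var       : ℕ → Term
  0ᵗ 1ᵗ     : Term
  -ᵗ_ _⁻¹ᵗ  : Term → Term
  _+ᵗ_ _*ᵗ_ : Term → Term → Term

data Axiom : Term → Term → Set where
  +ᵗ-assoc       : ∀ {x y z} → Axiom ((x +ᵗ y) +ᵗ z) (x +ᵗ (y +ᵗ z))
  +ᵗ-identityˡ   : ∀ {x} → Axiom (0ᵗ +ᵗ x) x
  +ᵗ-identityʳ   : ∀ {x} → Axiom (x +ᵗ 0ᵗ) x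
  -ᵗ-inverseˡ    : ∀ {x} → Axiom (-ᵗ x +ᵗ x) 0ᵗ
  -ᵗ-inverseʳ    : ∀ {x} → Axiom (x +ᵗ -ᵗ x) 0ᵗ
  +ᵗ-comm        : ∀ {x y} → Axiom (x +ᵗ y) (y +ᵗ x)
  *ᵗ-assoc       : ∀ {x y z} → Axiom ((x *ᵗ y) *ᵗ z) (x *ᵗ (y *ᵗ z))
  *ᵗ-identityˡ   : ∀ {x} → Axiom (1ᵗ *ᵗ x) x
  *ᵗ-identityʳ   : ∀ {x} → Axiom (x *ᵗ 1ᵗ) x
  distribˡᵗ      : ∀ {x y z} → Axiom (x *ᵗ (y +ᵗ z)) (x *ᵗ y +ᵗ x *ᵗ z)
  distribʳᵗ      : ∀ {x y z} → Axiom ((y +ᵗ z) *ᵗ x) (y *ᵗ x +ᵗ z *ᵗ x)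
  *ᵗ-comm        : ∀ {x y} → Axiom (x *ᵗ y) (y *ᵗ x)
  ⁻¹ᵗ-involutive : ∀ {x} → Axiom (x ⁻¹ᵗ ⁻¹ᵗ) x
  risᵗ           : ∀ {x} → Axiom (x *ᵗ (x *ᵗ x ⁻¹ᵗ)) x

infix 4 _⊢_≐_
data _⊢_≐_ {h : Level} (H : Term → Set h) : Term → Term → Set h where
  hyp      : ∀ {t} → H t → H ⊢ t ≐ 0ᵗ
  axiom    : ∀ {t u} → Axiom t u → H ⊢ t ≐ u
  ≐-refl   : ∀ {t} → H ⊢ t ≐ t
  ≐-sym    : ∀ {t u} → H ⊢ t ≐ u → H ⊢ u ≐ t
  ≐-trans  : ∀ {t u v} → H ⊢ t ≐ u → H ⊢ u ≐ v → H ⊢ t ≐ v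
  +ᵗ-cong  : ∀ {t t′ u u′} → H ⊢ t ≐ t′ → H ⊢ u ≐ u′ → H ⊢ t +ᵗ u ≐ t′ +ᵗ u′
  *ᵗ-cong  : ∀ {t t′ u u′} → H ⊢ t ≐ t′ → H ⊢ u ≐ u′ → H ⊢ t *ᵗ u ≐ t′ *ᵗ u′
  -ᵗ-cong  : ∀ {t t′} → H ⊢ t ≐ t′ → H ⊢ -ᵗ t ≐ -ᵗ t′
  ⁻¹ᵗ-cong : ∀ {t t′} → H ⊢ t ≐ t′ → H ⊢ t ⁻¹ᵗ ≐ t′ ⁻¹ᵗ

module _ {h h′ : Level} {H : Term → Set h} {H′ : Term → Set h′} where

  ⊢-weaken : (∀ {t} → H t → H′ t) → ∀ {t u} → H ⊢ t ≐ u → H′ ⊢ t ≐ u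
  ⊢-weaken f (hyp x)       = hyp (f x)
  ⊢-weaken f (axiom a)     = axiom a
  ⊢-weaken f ≐-refl        = ≐-refl
  ⊢-weaken f (≐-sym d)     = ≐-sym (⊢-weaken f d)
  ⊢-weaken f (≐-trans d e) = ≐-trans (⊢-weaken f d) (⊢-weaken f e)
  ⊢-weaken f (+ᵗ-cong d e) = +ᵗ-cong (⊢-weaken f d) (⊢-weaken f e)
  ⊢-weaken f (*ᵗ-cong d e) = *ᵗ-cong (⊢-weaken f d) (⊢-weaken f e)
  ⊢-weaken f (-ᵗ-cong d)   = -ᵗ-cong (⊢-weaken f d)
  ⊢-weaken f (⁻¹ᵗ-cong d)  = ⁻¹ᵗ-cong (⊢-weaken f d)

module _ {h : Level} {H : Term → Set h} where

  private
    Pure : Term → Term → Set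
    Pure t u = (λ _ → ⊥) ⊢ t ≐ u

    lift₂ : ∀ {t u t′ u′ t″ u″} → (Pure t u → Pure t′ u′ → Pure t″ u″) →
            Σ Term H ⊎ Pure t u → Σ Term H ⊎ Pure t′ u′ → Σ Term H ⊎ Pure t″ u″
    lift₂ f (inj₁ x) _        = inj₁ x
    lift₂ f (inj₂ _) (inj₁ x) = inj₁ x
    lift₂ f (inj₂ d) (inj₂ e) = inj₂ (f d e)

  ⊢-hyp⊎pure : ∀ {t u} → H ⊢ t ≐ u → Σ Term H ⊎ (λ _ → ⊥) ⊢ t ≐ u
  ⊢-hyp⊎pure (hyp x)       = inj₁ (_ , x)
  ⊢-hyp⊎pure (axiom a)     = inj₂ (axiom a)
  ⊢-hyp⊎pure ≐-refl        = inj₂ ≐-refl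
  ⊢-hyp⊎pure (≐-sym d)     = map₂ ≐-sym (⊢-hyp⊎pure d)
  ⊢-hyp⊎pure (≐-trans d e) = lift₂ ≐-trans (⊢-hyp⊎pure d) (⊢-hyp⊎pure e)
  ⊢-hyp⊎pure (+ᵗ-cong d e) = lift₂ +ᵗ-cong (⊢-hyp⊎pure d) (⊢-hyp⊎pure e)
  ⊢-hyp⊎pure (*ᵗ-cong d e) = lift₂ *ᵗ-cong (⊢-hyp⊎pure d) (⊢-hyp⊎pure e)
  ⊢-hyp⊎pure (-ᵗ-cong d)   = map₂ -ᵗ-cong (⊢-hyp⊎pure d)
  ⊢-hyp⊎pure (⁻¹ᵗ-cong d)  = map₂ ⁻¹ᵗ-cong (⊢-hyp⊎pure d)

ascend : ∀ {h} {F : ℕ → Set h} → (∀ {m} → F m → F (suc m)) → ∀ {m n} → m ≤′ n → F m → F n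
ascend step (≤′-reflexive refl) = id
ascend step (≤′-step m≤n)       = step ∘′ ascend step m≤n

⋃ : ∀ {h} → (ℕ → Term → Set h) → Term → Set h
⋃ H t = Σ ℕ λ m → H m t

module _ {h : Level} (H : ℕ → Term → Set h) (H-ascending : ∀ {m t} → H m t → H (suc m) t) where

  private
    AtSomeStage : Term → Term → Set h
    AtSomeStage t u = Σ ℕ λ K → H K ⊢ t ≐ u

    H-≤ : ∀ {m n t} → m ≤ n → H m t → H n t
    H-≤ {t = t} m≤n = ascend {F = λ i → H i t} H-ascending (≤⇒≤′ m≤n)

    join : ∀ {t u t′ u′ t″ u″} →
           (∀ {K} → H K ⊢ t ≐ u → H K ⊢ t′ ≐ u′ → H K ⊢ t″ ≐ u″) →
           AtSomeStage t u → AtSomeStage t′ u′ → AtSomeStage t″ u″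
    join f (K₁ , d) (K₂ , e) =
      K₁ ℕ.+ K₂ , f (⊢-weaken (H-≤ (m≤m+n K₁ K₂)) d) (⊢-weaken (H-≤ (m≤n+m K₂ K₁)) e)

  ⊢-compact : ∀ {t u} → ⋃ H ⊢ t ≐ u → Σ ℕ λ K → H K ⊢ t ≐ u
  ⊢-compact (hyp (m , x))  = m , hyp x
  ⊢-compact (axiom a)      = 0 , axiom a
  ⊢-compact ≐-refl         = 0 , ≐-refl
  ⊢-compact (≐-sym d)      = Product.map₂ ≐-sym (⊢-compact d)
  ⊢-compact (≐-trans d e)  = join ≐-trans (⊢-compact d) (⊢-compact e)
  ⊢-compact (+ᵗ-cong d e)  = join +ᵗ-cong (⊢-compact d) (⊢-compact e)
  ⊢-compact (*ᵗ-cong d e)  = join *ᵗ-cong (⊢-compact d) (⊢-compact e)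
  ⊢-compact (-ᵗ-cong d)    = Product.map₂ -ᵗ-cong (⊢-compact d)
  ⊢-compact (⁻¹ᵗ-cong d)   = Product.map₂ ⁻¹ᵗ-cong (⊢-compact d)

module Evaluation {c ℓ : Level} (M : Meadow c ℓ) (ρ : ℕ → Meadow.Carrier M) where
  open Meadow M renaming (refl to ≈-refl; sym to ≈-sym; trans to ≈-trans)

  ⟦_⟧ : Term → Carrier
  ⟦ var x ⟧  = ρ x
  ⟦ 0ᵗ ⟧     = 0#
  ⟦ 1ᵗ ⟧     = 1#
  ⟦ -ᵗ t ⟧   = - ⟦ t ⟧
  ⟦ t ⁻¹ᵗ ⟧  = ⟦ t ⟧ ⁻¹
  ⟦ t +ᵗ u ⟧ = ⟦ t ⟧ + ⟦ u ⟧
  ⟦ t *ᵗ u ⟧ = ⟦ t ⟧ * ⟦ u ⟧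

  axiom-sound : ∀ {t u} → Axiom t u → ⟦ t ⟧ ≈ ⟦ u ⟧
  axiom-sound +ᵗ-assoc       = +-assoc _ _ _
  axiom-sound +ᵗ-identityˡ   = +-identityˡ _
  axiom-sound +ᵗ-identityʳ   = +-identityʳ _
  axiom-sound -ᵗ-inverseˡ    = -‿inverseˡ _
  axiom-sound -ᵗ-inverseʳ    = -‿inverseʳ _
  axiom-sound +ᵗ-comm        = +-comm _ _
  axiom-sound *ᵗ-assoc       = *-assoc _ _ _
  axiom-sound *ᵗ-identityˡ   = *-identityˡ _
  axiom-sound *ᵗ-identityʳ   = *-identityʳ _
  axiom-sound distribˡᵗ      = distribˡ _ _ _
  axiom-sound distribʳᵗ      = distribʳ _ _ _
  axiom-sound *ᵗ-comm        = *-comm _ _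
  axiom-sound ⁻¹ᵗ-involutive = ⁻¹-involutive _
  axiom-sound risᵗ           = ris _

  ⊢-sound : ∀ {h} {H : Term → Set h} → (∀ {t} → H t → ⟦ t ⟧ ≈ 0#) →
            ∀ {t u} → H ⊢ t ≐ u → ⟦ t ⟧ ≈ ⟦ u ⟧
  ⊢-sound H-sound (hyp x)       = H-sound x
  ⊢-sound H-sound (axiom a)     = axiom-sound a
  ⊢-sound H-sound ≐-refl        = ≈-refl
  ⊢-sound H-sound (≐-sym d)     = ≈-sym (⊢-sound H-sound d)
  ⊢-sound H-sound (≐-trans d e) = ≈-trans (⊢-sound H-sound d) (⊢-sound H-sound e)
  ⊢-sound H-sound (+ᵗ-cong d e) = +-cong (⊢-sound H-sound d) (⊢-sound H-sound e)
  ⊢-sound H-sound (*ᵗ-cong d e) = *-cong (⊢-sound H-sound d) (⊢-sound H-sound e)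
  ⊢-sound H-sound (-ᵗ-cong d)   = -‿cong (⊢-sound H-sound d)
  ⊢-sound H-sound (⁻¹ᵗ-cong d)  = ⁻¹-cong (⊢-sound H-sound d)

termMeadow : {c ℓ : Level} → (Term → Set ℓ) → Meadow c ℓ
termMeadow {c} H = record
  { commutativeRing = record
    { Carrier = Lift c Term
    ; _≈_ = λ x y → H ⊢ lower x ≐ lower y
    ; _+_ = λ x y → lift (lower x +ᵗ lower y)
    ; _*_ = λ x y → lift (lower x *ᵗ lower y)
    ; -_  = λ x → lift (-ᵗ lower x)
    ; 0#  = lift 0ᵗ
    ; 1#  = lift 1ᵗ
    ; isCommutativeRing = record
      { isRing = record
        { +-isAbelianGroup = record
          { isGroup = record
            { isMonoid = record
              { isSemigroup = record
                { isMagma = record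
                  { isEquivalence = record { refl = ≐-refl ; sym = ≐-sym ; trans = ≐-trans }
                  ; ∙-cong = +ᵗ-cong }
                ; assoc = λ _ _ _ → axiom +ᵗ-assoc }
              ; identity = (λ _ → axiom +ᵗ-identityˡ) , (λ _ → axiom +ᵗ-identityʳ) }
            ; inverse = (λ _ → axiom -ᵗ-inverseˡ) , (λ _ → axiom -ᵗ-inverseʳ)
            ; ⁻¹-cong = -ᵗ-cong }
          ; comm = λ _ _ → axiom +ᵗ-comm }
        ; *-cong = *ᵗ-cong
        ; *-assoc = λ _ _ _ → axiom *ᵗ-assoc
        ; *-identity = (λ _ → axiom *ᵗ-identityˡ) , (λ _ → axiom *ᵗ-identityʳ)
        ; distrib = (λ _ _ _ → axiom distribˡᵗ) , (λ _ _ _ → axiom distribʳᵗ) }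
      ; *-comm = λ _ _ → axiom *ᵗ-comm } }
  ; _⁻¹ = λ x → lift (lower x ⁻¹ᵗ)
  ; ⁻¹-cong = ⁻¹ᵗ-cong
  ; ⁻¹-involutive = λ _ → axiom ⁻¹ᵗ-involutive
  ; ris = λ _ → axiom risᵗ
  }

⟦⟧-termMeadow : {c ℓ : Level} {H : Term → Set ℓ} →
                ∀ t → lower (Evaluation.⟦_⟧ (termMeadow {c} H) (lift ∘′ var) t) ≡ t
⟦⟧-termMeadow (var x)  = refl
⟦⟧-termMeadow 0ᵗ       = refl
⟦⟧-termMeadow 1ᵗ       = refl
⟦⟧-termMeadow (-ᵗ t)   = cong -ᵗ_ (⟦⟧-termMeadow t)
⟦⟧-termMeadow (t ⁻¹ᵗ)  = cong _⁻¹ᵗ (⟦⟧-termMeadow t)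
⟦⟧-termMeadow (t +ᵗ u) = cong₂ _+ᵗ_ (⟦⟧-termMeadow t) (⟦⟧-termMeadow u)
⟦⟧-termMeadow (t *ᵗ u) = cong₂ _*ᵗ_ (⟦⟧-termMeadow t) (⟦⟧-termMeadow u)

record SymState : Set where
  constructor symState
  field
    inpˢ : Input → Term
    auxˢ : Aux → Term
open SymState public

updateˢ : (Aux → Term) → Aux → Term → (Aux → Term)
updateˢ f a t b with b ≟ a
... | yes _ = t
... | no  _ = f b

execˢ : Assign → SymState → SymState
execˢ (cp a x)   s = symState (inpˢ s) (updateˢ (auxˢ s) a (inpˢ s x))
execˢ (set0 a)   s = symState (inpˢ s) (updateˢ (auxˢ s) a 0ᵗ)
execˢ (set1 a)   s = symState (inpˢ s) (updateˢ (auxˢ s) a 1ᵗ)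
execˢ (ai a)     s = symState (inpˢ s) (updateˢ (auxˢ s) a (-ᵗ auxˢ s a))
execˢ (mi a)     s = symState (inpˢ s) (updateˢ (auxˢ s) a (auxˢ s a ⁻¹ᵗ))
execˢ (add a a′) s = symState (inpˢ s) (updateˢ (auxˢ s) a (auxˢ s a +ᵗ auxˢ s a′))
execˢ (mul a a′) s = symState (inpˢ s) (updateˢ (auxˢ s) a (auxˢ s a *ᵗ auxˢ s a′))
execˢ (out a)    s = s

initialˢ : ℕ → SymState
initialˢ k = symState inputs (λ _ → 0ᵗ)
  where
    inputs : Input → Term
    inputs x with x <? suc k
    ... | yes _ = var x
    ... | no  _ = 0ᵗ

module Symbolic {c ℓ : Level} (M : Meadow c ℓ) (ρ : ℕ → Meadow.Carrier M) where
  open Meadow M renaming (refl to ≈-refl)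
  open Sem M
  open Evaluation M ρ

  record Describes (σ : State) (s : SymState) : Set ℓ where
    constructor mkDescribes
    field
      inp≈ : ∀ x → inp σ x ≈ ⟦ inpˢ s x ⟧
      aux≈ : ∀ b → aux σ b ≈ ⟦ auxˢ s b ⟧
  open Describes public

  private
    assign-describes : ∀ {σ s} a {v t} → Describes σ s → v ≈ ⟦ t ⟧ →
                       Describes (state (inp σ) (update (aux σ) a v) (outv σ))
                                 (symState (inpˢ s) (updateˢ (auxˢ s) a t))
    assign-describes {σ} {s} a {v} {t} d v≈t = mkDescribes (inp≈ d) updated
      where
        updated : ∀ b → update (aux σ) a v b ≈ ⟦ updateˢ (auxˢ s) a t b ⟧
        updated b with b ≟ a
        ... | yes _ = v≈t
        ... | no  _ = aux≈ d b

  exec-describes : ∀ a {σ s} → Describes σ s → Describes (exec a σ) (execˢ a s)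
  exec-describes (cp a x)   d = assign-describes a d (inp≈ d x)
  exec-describes (set0 a)   d = assign-describes a d ≈-refl
  exec-describes (set1 a)   d = assign-describes a d ≈-refl
  exec-describes (ai a)     d = assign-describes a d (-‿cong (aux≈ d a))
  exec-describes (mi a)     d = assign-describes a d (⁻¹-cong (aux≈ d a))
  exec-describes (add a a′) d = assign-describes a d (+-cong (aux≈ d a) (aux≈ d a′))
  exec-describes (mul a a′) d = assign-describes a d (*-cong (aux≈ d a) (aux≈ d a′))
  exec-describes (out a)    d = mkDescribes (inp≈ d) (aux≈ d)

  initial-describes : ∀ k {ms} → (∀ {x} (x<k : x < suc k) → ms (fromℕ< x<k) ≈ ρ x) →
                      Describes (initial k ms) (initialˢ k)
  initial-describes k ms≈ρ = mkDescribes inputs≈ λ _ → ≈-refl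
    where
      inputs≈ : ∀ x → inp (initial k _) x ≈ ⟦ inpˢ (initialˢ k) x ⟧
      inputs≈ x with x <? suc k
      ... | yes x<k = ms≈ρ x<k
      ... | no  _   = ≈-refl

module _ {c ℓ : Level} (M : Meadow c ℓ) where
  open Meadow M using (_≈_) renaming (refl to ≈-refl)
  open Sem M using (inp; initial)

  initial-inputs : ∀ k ms {x} (x<k : x < suc k) → ms (fromℕ< x<k) ≈ inp (initial k ms) x
  initial-inputs k ms {x} x<k with x <? suc k
  ... | yes _   = ≈-refl
  ... | no  x≮k = ⊥-elim (x≮k x<k)

module TermStates {c ℓ : Level} (H : Term → Set ℓ) where
  open Sem (termMeadow {c} H)
  open Symbolic (termMeadow {c} H) (lift ∘′ var)

  aux-≐ : ∀ {σ s} → Describes σ s → ∀ b → H ⊢ lower (aux σ b) ≐ auxˢ s b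
  aux-≐ {σ} {s} d b = subst (H ⊢ lower (aux σ b) ≐_) (⟦⟧-termMeadow (auxˢ s b)) (aux≈ d b)

  varInputs : ∀ k → Fin (suc k) → Lift c Term
  varInputs k i = lift (var (toℕ i))

  initial-describesᵗ : ∀ k → Describes (initial k (varInputs k)) (initialˢ k)
  initial-describesᵗ k = initial-describes k λ x<k →
    subst (λ x → H ⊢ var (toℕ (fromℕ< x<k)) ≐ var x) (toℕ-fromℕ< x<k) ≐-refl

module Paths {p : Level} {X : Set} (P : X → Set p) (children : X → List X) where

  data Survives : ℕ → X → Set p where
    ends  : ∀ {x} → P x → Survives zero x
    _◂_   : ∀ {n x} → P x → Any (Survives n) (children x) → Survives (suc n) x

  survives⇒P : ∀ {n x} → Survives n x → P x
  survives⇒P (ends px)  = px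
  survives⇒P (px ◂ _)   = px

  survives-pred : ∀ {n x} → Survives (suc n) x → Survives n x
  survives-pred {zero}  (px ◂ _) = ends px
  survives-pred {suc n} (px ◂ s) = px ◂ Any.map survives-pred s

  survives-≤ : ∀ {m n x} → m ≤′ n → Survives n x → Survives m x
  survives-≤ (≤′-reflexive refl) = id
  survives-≤ (≤′-step m≤n)       = survives-≤ m≤n ∘′ survives-pred

  dead-parent : ∀ {n x} → All (¬_ ∘′ Survives n) (children x) → ¬ Survives (suc n) x
  dead-parent dead (_ ◂ s) = All¬⇒¬Any dead s

  dead-child : ∀ {n x y} → P x → ¬ Survives (suc n) x → y ∈ children x → ¬ Survives n y
  dead-child px dead y∈ s = dead (px ◂ lose y∈ s)

  children-survive : ∀ {n x} → Survives (suc n) x → Any (Survives n) (children x)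
  children-survive (_ ◂ s) = s

  Immortal : X → Set p
  Immortal x = ∀ n → Survives n x

  module InfinitePath (em : ExcludedMiddle p) {x₀ : X} (x₀-immortal : Immortal x₀) where

    private
      dne = em⇒dne em

      mortal⇒dies : ∀ {y} → ¬ Immortal y → Σ ℕ λ N → ¬ Survives N y
      mortal⇒dies mortal = dne λ never → mortal λ n → dne λ dead → never (n , dead)

      survivors-after : ∀ {y ys N} → ¬ Survives N y →
                        (∀ n → Any (Survives n) (y ∷ ys)) → ∀ n → Any (Survives n) ys
      survivors-after {N = N} dead s n with s (n ℕ.+ N)
      ... | here  s-y  = ⊥-elim (dead (survives-≤ (≤⇒≤′ (m≤n+m N n)) s-y))
      ... | there s-ys = Any.map (survives-≤ (≤⇒≤′ (m≤m+n n N))) s-ys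

      immortal-any : ∀ {ys} → (∀ n → Any (Survives n) ys) → Any Immortal ys
      immortal-any {[]}     s with s 0
      ... | ()
      immortal-any {y ∷ ys} s with em {Immortal y}
      ... | yes y-immortal = here y-immortal
      ... | no  y-mortal   =
        let N , dead = mortal⇒dies y-mortal in there (immortal-any (survivors-after {N = N} dead s))

      immortal-child : ∀ {x} → Immortal x → Σ X λ y → y ∈ children x × Immortal y
      immortal-child immortal = find (immortal-any (λ n → children-survive (immortal (suc n))))

      walk : ℕ → Σ X Immortal
      walk zero    = x₀ , x₀-immortal
      walk (suc m) = let y , _ , y-immortal = immortal-child (proj₂ (walk m)) in y , y-immortal

    path : ℕ → X
    path m = proj₁ (walk m)

    path-immortal : ∀ m → Immortal (path m)
    path-immortal m = proj₂ (walk m)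

    path-child : ∀ m → path (suc m) ∈ children (path m)
    path-child m = proj₁ (proj₂ (immortal-child (proj₂ (walk m))))

DecidedUnless : ∀ {ℓ} → Set ℓ → Set (lsuc ℓ)
DecidedUnless {ℓ} B = (Q : Set ℓ) → Q ⊎ ¬ Q ⊎ B

decidedUnless⇒ : ∀ {ℓ} {B : Set ℓ} → DecidedUnless B → (ExcludedMiddle ℓ → ¬ ¬ B) → B
decidedUnless⇒ {B = B} decided classical with decided B
... | inj₁ b         = b
... | inj₂ (inj₂ b)  = b
... | inj₂ (inj₁ ¬b) = ⊥-elim (classical em ¬b)
  where
    em : ExcludedMiddle _
    em {Q} with decided Q
    ... | inj₁ q         = yes q
    ... | inj₂ (inj₁ ¬q) = no ¬q
    ... | inj₂ (inj₂ b)  = ⊥-elim (¬b b)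

module ExecutionTree {ℓ : Level} (T : RegThread) where
  open RegThread T

  record Config : Set where
    constructor config
    field
      position : Fin size
      store    : SymState
      zeros    : List Term
      nonzeros : List Term
  open Config public

  Zeros : Config → Term → Set ℓ
  Zeros γ t = Lift ℓ (t ∈ zeros γ)

  Consistent : Config → Set ℓ
  Consistent γ = ∀ {u} → u ∈ nonzeros γ → ¬ (Zeros γ ⊢ u ≐ 0ᵗ)

  after : Assign → Fin size → Config → Config
  after a j γ = config j (execˢ a (store γ)) (zeros γ) (nonzeros γ)

  assumeZero : Aux → Fin size → Config → Config
  assumeZero a j γ = config j (store γ) (auxˢ (store γ) a ∷ zeros γ) (nonzeros γ)

  assumeNonzero : Aux → Fin size → Config → Config
  assumeNonzero a l γ = config l (store γ) (zeros γ) (auxˢ (store γ) a ∷ nonzeros γ)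

  childrenAt : Node size → Config → List Config
  childrenAt S            γ = []
  childrenAt D            γ = []
  childrenAt (a ∘ j)      γ = after a j γ ∷ []
  childrenAt (test a j l) γ = assumeZero a j γ ∷ assumeNonzero a l γ ∷ []

  children : Config → List Config
  children γ = childrenAt (node (position γ)) γ

  open Paths Consistent children public

  initialConfig : ℕ → Config
  initialConfig k = config start (initialˢ k) [] []

  child-extends : ∀ {γ γ′} → γ′ ∈ children γ →
                  zeros γ ⊆ zeros γ′ × nonzeros γ ⊆ nonzeros γ′
  child-extends {γ} _ with node (position γ)
  child-extends (here refl)         | _ ∘ _      = id , id
  child-extends (here refl)         | test _ _ _ = there , id
  child-extends (there (here refl)) | test _ _ _ = id , there

  children-at : ∀ {γ nd} → node (position γ) ≡ nd → childrenAt nd γ ≡ children γ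
  children-at {γ} eq = cong (λ nd → childrenAt nd γ) (sym eq)

  unfoldNode : (Fin size → FinThread) → Node size → FinThread
  unfoldNode f S            = S
  unfoldNode f D            = D
  unfoldNode f (a ∘ j)      = a ∘ f j
  unfoldNode f (test a j l) = test a (f j) (f l)

  unfold : ℕ → Fin size → FinThread
  unfold zero    i = D
  unfold (suc n) i = unfoldNode (unfold n) (node i)

  module _ {c : Level} (M : Meadow c ℓ) where
    open Meadow M renaming (refl to ≈-refl; sym to ≈-sym; trans to ≈-trans)
    open Sem M

    unfold-sound : ∀ n i {σ w} → RunF (unfold n i) σ w → RunR T i σ w
    unfold-sound (suc n) i r with node i in eq
    unfold-sound (suc n) i stop          | S          = stop eq
    unfold-sound (suc n) i (step r)      | a ∘ j      = step eq (unfold-sound n j r)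
    unfold-sound (suc n) i (testT z r)   | test a j l = testT eq z (unfold-sound n j r)
    unfold-sound (suc n) i (testF z r)   | test a j l = testF eq z (unfold-sound n l r)

    module _ (ρ : ℕ → Carrier) where
      open Evaluation M ρ
      open Symbolic M ρ

      record Realises (σ : State) (γ : Config) : Set ℓ where
        constructor realises
        field
          describes  : Describes σ (store γ)
          zeros≈0    : ∀ {t} → t ∈ zeros γ → ⟦ t ⟧ ≈ 0#
          nonzeros≉0 : ∀ {t} → t ∈ nonzeros γ → ¬ ⟦ t ⟧ ≈ 0#

      realises⇒consistent : ∀ {σ γ} → Realises σ γ → Consistent γ
      realises⇒consistent (realises _ zs nzs) u∈ d = nzs u∈ (⊢-sound (zs ∘′ lower) d)

      realises-after : ∀ {σ γ} a j → Realises σ γ → Realises (exec a σ) (after a j γ)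
      realises-after a j (realises d zs nzs) = realises (exec-describes a d) zs nzs

      realises-assumeZero : ∀ {σ γ} a j → aux σ a ≈ 0# →
                            Realises σ γ → Realises σ (assumeZero a j γ)
      realises-assumeZero a j z (realises d zs nzs) = realises d zs′ nzs
        where
          zs′ : ∀ {t} → t ∈ _ → ⟦ t ⟧ ≈ 0#
          zs′ (here refl) = ≈-trans (≈-sym (aux≈ d a)) z
          zs′ (there t∈)  = zs t∈

      realises-assumeNonzero : ∀ {σ γ} a l → ¬ aux σ a ≈ 0# →
                               Realises σ γ → Realises σ (assumeNonzero a l γ)
      realises-assumeNonzero a l nz (realises d zs nzs) = realises d zs nzs′
        where
          nzs′ : ∀ {t} → t ∈ _ → ¬ ⟦ t ⟧ ≈ 0#
          nzs′ (here refl) t≈0 = nz (≈-trans (aux≈ d a) t≈0)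
          nzs′ (there t∈)      = nzs t∈

      unfold-complete : ∀ n {γ σ v} → Realises σ γ → ¬ Survives n γ →
                        RunR T (position γ) σ v → RunF (unfold n (position γ)) σ v
      unfold-complete zero    re dead _ = ⊥-elim (dead (ends (realises⇒consistent re)))
      unfold-complete (suc n) {γ} {σ} {v} re dead r = go r
        where
          at : ∀ {nd} → node (position γ) ≡ nd → RunF (unfoldNode (unfold n) nd) σ v →
               RunF (unfold (suc n) (position γ)) σ v
          at eq = subst (λ nd → RunF (unfoldNode (unfold n) nd) σ v) (sym eq)

          dead-at : ∀ {nd γ′} → node (position γ) ≡ nd → γ′ ∈ childrenAt nd γ → ¬ Survives n γ′
          dead-at eq γ′∈ =
            dead-child (realises⇒consistent re) dead (subst (_ ∈_) (children-at eq) γ′∈)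

          go : RunR T (position γ) σ v → RunF (unfold (suc n) (position γ)) σ v
          go (stop eq) = at eq stop
          go (step {a = a} {j = j} eq r) =
            at eq (step (unfold-complete n (realises-after a j re) (dead-at eq (here refl)) r))
          go (testT {a = a} {j = j} eq z r) =
            at eq (testT z (unfold-complete n (realises-assumeZero a j z re)
                                               (dead-at eq (here refl)) r))
          go (testF {a = a} {l = l} eq nz r) =
            at eq (testF nz (unfold-complete n (realises-assumeNonzero a l nz re)
                                                (dead-at eq (there (here refl))) r))

    initial-realises : ∀ k ms → Realises (inp (initial k ms)) (initial k ms) (initialConfig k)
    initial-realises k ms =
      realises (Symbolic.initial-describes M _ k (initial-inputs M k ms)) (λ ()) (λ ())

  Bounded : ℕ → Set ℓ
  Bounded k = Σ ℕ λ N → ¬ Survives N (initialConfig k)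

  Total : (c : Level) → ℕ → Set (lsuc (c ⊔ ℓ))
  Total c k = (M : Meadow c ℓ) (ms : Fin (suc k) → Meadow.Carrier M) →
              Σ (Meadow.Carrier M) (Sem.⟦_⟧R^_ M T k ms)

  module Dichotomy {c : Level} (Q : Set ℓ) where
    open Sem (termMeadow {c} (λ _ → Q))
    open Symbolic (termMeadow {c} (λ _ → Q)) (lift ∘′ var)
    open TermStates {c} (λ _ → Q)

    private
      Outcome : Config → Set ℓ
      Outcome γ = Q ⊎ ¬ Q ⊎ Σ ℕ λ N → ¬ Survives N γ

      extend : ∀ {γ nd γ′} → node (position γ) ≡ nd →
               (∀ {N} → ¬ Survives N γ′ → All (¬_ ∘′ Survives N) (childrenAt nd γ)) →
               Outcome γ′ → Outcome γ
      extend eq dead-children = map₂ (map₂ λ (N , dead) →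
        suc N , dead-parent (subst (All _) (children-at eq) (dead-children dead)))

    decide-or-bound : ∀ {γ σ v} → Describes σ (store γ) → RunR T (position γ) σ v → Outcome γ
    decide-or-bound d (stop eq) = inj₂ (inj₂ (1 , dead-parent (subst (All _) (children-at eq) [])))
    decide-or-bound d (step {a = a} eq r) = extend eq (_∷ []) (decide-or-bound (exec-describes a d) r)
    decide-or-bound {γ} d (testT {a = a} {l = l} eq z r)
      with ⊢-hyp⊎pure (≐-trans (≐-sym (aux-≐ d a)) z)
    ... | inj₁ (_ , q) = inj₁ q
    ... | inj₂ pure    = extend eq (λ dead → dead ∷ inconsistent ∷ []) (decide-or-bound d r)
      where
        inconsistent : ∀ {N} → ¬ Survives N (assumeNonzero a l γ)
        inconsistent s = survives⇒P s (here refl) (⊢-weaken (λ ()) pure)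
    decide-or-bound d (testF eq nz r) = inj₂ (inj₁ λ q → nz (hyp q))

  decided-unless-bounded : ∀ {c k} → Total c k → DecidedUnless (Bounded k)
  decided-unless-bounded {c} {k} total Q =
    decide-or-bound (initial-describesᵗ k) (proj₂ (total (termMeadow (λ _ → Q)) (varInputs k)))
    where
      open Dichotomy {c} Q
      open TermStates {c} (λ _ → Q)

  module Limit {c : Level} (em : ExcludedMiddle ℓ) {k : ℕ} (immortal : Immortal (initialConfig k)) where
    open InfinitePath em immortal

    ZerosAt : ℕ → Term → Set ℓ
    ZerosAt m = Zeros (path m)

    private
      ZerosAt-ascending : ∀ m {t} → ZerosAt m t → ZerosAt (suc m) t
      ZerosAt-ascending m (lift t∈) = lift (proj₁ (child-extends (path-child m)) t∈)

      zeros-≤ : ∀ {m n} → m ≤ n → zeros (path m) ⊆ zeros (path n)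
      zeros-≤ m≤n {t} = ascend {F = λ i → t ∈ zeros (path i)}
        (λ {i} → proj₁ (child-extends (path-child i))) (≤⇒≤′ m≤n)

      nonzeros-≤ : ∀ {m n} → m ≤ n → nonzeros (path m) ⊆ nonzeros (path n)
      nonzeros-≤ m≤n {t} = ascend {F = λ i → t ∈ nonzeros (path i)}
        (λ {i} → proj₂ (child-extends (path-child i))) (≤⇒≤′ m≤n)

    limit-consistent : ∀ m {u} → u ∈ nonzeros (path m) → ¬ (⋃ ZerosAt ⊢ u ≐ 0ᵗ)
    limit-consistent m u∈ d with ⊢-compact ZerosAt (λ {i} → ZerosAt-ascending i) d
    ... | K , dK with path-immortal (K ℕ.+ m) 0
    ... | ends consistent =
      consistent (nonzeros-≤ (m≤n+m m K) u∈)
                 (⊢-weaken (lift ∘′ zeros-≤ (m≤m+n K m) ∘′ lower) dK)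

    open Sem (termMeadow {c} (⋃ ZerosAt))
    open Symbolic (termMeadow {c} (⋃ ZerosAt)) (lift ∘′ var)
    open TermStates {c} (⋃ ZerosAt)

    private
      next : ∀ m {γ nd} → path m ≡ γ → node (position γ) ≡ nd → path (suc m) ∈ childrenAt nd γ
      next m refl eq = subst (_ ∈_) (sym (children-at eq)) (path-child m)

      zero-assumed : ∀ m γ a {j} → path m ≡ assumeZero a j γ → ⋃ ZerosAt ⊢ auxˢ (store γ) a ≐ 0ᵗ
      zero-assumed m _ _ e = hyp (m , lift (subst (λ γ′ → _ ∈ zeros γ′) (sym e) (here refl)))

      nonzero-assumed : ∀ m γ a {l} → path m ≡ assumeNonzero a l γ →
                        ¬ (⋃ ZerosAt ⊢ auxˢ (store γ) a ≐ 0ᵗ)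
      nonzero-assumed m _ _ e = limit-consistent m (subst (λ γ′ → _ ∈ nonzeros γ′) (sym e) (here refl))

    no-run : ∀ m {γ σ v} → path m ≡ γ → Describes σ (store γ) → RunR T (position γ) σ v → ⊥
    no-run m e d (stop eq) with next m e eq
    ... | ()
    no-run m e d (step {a = a} eq r) with next m e eq
    ... | here e′ = no-run (suc m) e′ (exec-describes a d) r
    no-run m {γ} e d (testT {a = a} eq z r) with next m e eq
    ... | here e′         = no-run (suc m) e′ d r
    ... | there (here e′) = nonzero-assumed (suc m) γ a e′ (≐-trans (≐-sym (aux-≐ d a)) z)
    no-run m {γ} e d (testF {a = a} eq nz r) with next m e eq
    ... | here e′         = nz (≐-trans (aux-≐ d a) (zero-assumed (suc m) γ a e′))
    ... | there (here e′) = no-run (suc m) e′ d r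

  not-not-bounded : ∀ {c k} → Total c k → ExcludedMiddle ℓ → ¬ ¬ Bounded k
  not-not-bounded {c} {k} total em unbounded =
    no-run 0 refl (initial-describesᵗ k) (proj₂ (total (termMeadow _) (varInputs k)))
    where
      immortal : Immortal (initialConfig k)
      immortal n = em⇒dne em λ dead → unbounded (n , dead)
      open Limit {c} em immortal
      open TermStates {c} (⋃ ZerosAt)

  bounded : ∀ {c k} → Total c k → Bounded k
  bounded total = decidedUnless⇒ (decided-unless-bounded total) (not-not-bounded total)

mainTheorem3 : {c ℓ : Level} (T : RegThread) (k : ℕ) →
    ((M : Meadow c ℓ) → (ms : Fin (suc k) → Meadow.Carrier M) →
      Σ (Meadow.Carrier M) (λ v → (Sem.⟦_⟧R^_ M T k) ms v)) →
    Σ FinThread (λ T′ → (M : Meadow c ℓ) → (ms : Fin (suc k) → Meadow.Carrier M) →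
      ((v : Meadow.Carrier M) → (Sem.⟦_⟧R^_ M T k) ms v →
        Σ (Meadow.Carrier M) (λ w → (Sem.⟦_⟧F^_ M T′ k) ms w × Meadow._≈_ M v w))
      × ((w : Meadow.Carrier M) → (Sem.⟦_⟧F^_ M T′ k) ms w →
        Σ (Meadow.Carrier M) (λ v → (Sem.⟦_⟧R^_ M T k) ms v × Meadow._≈_ M v w)))
mainTheorem3 {c} {ℓ} T k total = unfold N start , λ M ms →
    (λ v run → v , unfold-complete M _ N (initial-realises M k ms) dead run , Meadow.refl M)
  , (λ w run → w , unfold-sound M N start run , Meadow.refl M)
  where
    open RegThread T using (start)
    open ExecutionTree {ℓ} T
    N : ℕ
    N = proj₁ (bounded {c} total)
    dead : ¬ Survives N (initialConfig k)
    dead = proj₂ (bounded {c} total)
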